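{- Let $G$ be a finite graph. (a) If $s$ is a non-negative integer, then $G^{\frac{2s+1}{2s+1}}\longleftrightarrow G$. (b) If $s$ is a non-negative integer with $2s+1<og(G)$, then $(G^{2s+1})^{\frac{1}{2s+1}}\longrightarrow G$.
   Context: $G\longrightarrow H$ means there is a homomorphism (adjacency-preserving vertex map) from $G$ to $H$; $G\longleftrightarrow H$ means $G\longrightarrow H$ and $H\longrightarrow G$. $og(G)$ is the odd girth of $G$ ($\infty$ if $G$ is bipartite). For a positive integer $k$, $G^{k}$ has vertex set $V(G)$, with $u,v$ adjacent iff there is a walk of length $k$ between them in $G$ (loops allowed). $S_t(G)$ is obtained from $G$ by replacing each edge by a path with exactly $t-1$ inner vertices, and for non-negative integers $r,s$, $G^{\frac{2r+1}{2s+1}}:=(S_{2s+1}(G))^{2r+1}$; in particular $G^{\frac{1}{2s+1}}=S_{2s+1}(G)$. -}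

module Defs where

open import Data.Nat using (ℕ; zero; suc; _+_; _*_; _∸_; _≤_; _<?_)
open import Data.Nat.Properties using (+-suc)
open import Data.Fin as F using (Fin; fromℕ<; inject₁; fromℕ)
open import Data.Fin.Properties using (any?; _≟_)
open import Data.Product using (Σ; _×_; _,_; ∃; ∃-syntax)
open import Data.Product.Properties using ()
open import Data.Sum using (_⊎_; inj₁; inj₂)
open import Relation.Nullary using (¬_; Dec; yes; no)
open import Relation.Nullary.Decidable using (True; map′; _×-dec_)
open import Relation.Binary.PropositionalEquality using (_≡_; refl; subst; sym)
open import Function.Definitions using (Injective)

record Graph : Set₁ where
  field
    V : Set
    E : V → V → Set
open Graph public

_⟶_ : Graph → Graph → Set
G ⟶ H = Σ (V G → V H) λ f → ∀ {u v} → E G u v → E H (f u) (f v)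

_⟷_ : Graph → Graph → Set
G ⟷ H = (G ⟶ H) × (H ⟶ G)

record FinGraph : Set₁ where
  field
    n    : ℕ
    adj  : Fin n → Fin n → Set
    adj-sym : ∀ {u v} → adj u v → adj v u
    adj-dec : ∀ u v → Dec (adj u v)
open FinGraph public

toGraph : FinGraph → Graph
toGraph G = record { V = Fin (n G) ; E = adj G }

data Walk (G : Graph) : ℕ → V G → V G → Set where
  here : ∀ {u} → Walk G 0 u u
  step : ∀ {k u w v} → E G u w → Walk G k w v → Walk G (suc k) u v

_^[_] : Graph → ℕ → Graph
G ^[ k ] = record { V = V G ; E = Walk G k }

private
  snoc : ∀ {G : Graph} {k u w v} → Walk G k u w → E G w v → Walk G (suc k) u v
  snoc here e = step e here
  snoc (step e p) e′ = step e (snoc p e′)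

  rev : (G : FinGraph) → ∀ {k u v} → Walk (toGraph G) k u v → Walk (toGraph G) k v u
  rev G here = here
  rev G (step e p) = snoc (rev G p) (adj-sym G e)

  walk? : (G : FinGraph) → ∀ k u v → Dec (Walk (toGraph G) k u v)
  walk? G zero u v with u ≟ v
  ... | yes refl = yes here
  ... | no u≢v = no λ { here → u≢v refl }
  walk? G (suc k) u v =
    map′ (λ { (w , e , p) → step e p }) (λ { (step e p) → _ , e , p })
         (any? (λ w → adj-dec G u w ×-dec walk? G k w v))

_^ᶠ[_] : FinGraph → ℕ → FinGraph
G ^ᶠ[ k ] = record
  { n = n G
  ; adj = Walk (toGraph G) k
  ; adj-sym = rev G
  ; adj-dec = walk? G k
  }

-- Subdivision S_t(G): every edge {u,v} (u ≤ v, loops included) is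
-- replaced by a path u = p₀, p₁, …, p_{t-1}, p_t = v with t-1 new inner
-- vertices.  (Intended for t ≥ 1.)

record UEdge (G : FinGraph) : Set where
  constructor uedge
  field
    ends₁ : Fin (n G)
    ends₂ : Fin (n G)
    ordered : ends₁ F.≤ ends₂
    isEdge : True (adj-dec G ends₁ ends₂)
open UEdge public

data SubV (G : FinGraph) (t : ℕ) : Set where
  orig  : Fin (n G) → SubV G t
  inner : UEdge G → Fin (t ∸ 1) → SubV G t   -- inner j is position j+1

-- i-th vertex on the path replacing e (0 ≤ i ≤ t)
pathPos : ∀ {G t} → UEdge G → ℕ → SubV G t
pathPos e zero = orig (ends₁ e)
pathPos {t = t} e (suc j) with j <? t ∸ 1
... | yes j<t-1 = inner e (fromℕ< j<t-1)
... | no  _     = orig (ends₂ e)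

data SubE (G : FinGraph) (t : ℕ) : SubV G t → SubV G t → Set where
  fwd : (e : UEdge G) (i : Fin t) →
        SubE G t (pathPos e (F.toℕ i)) (pathPos e (suc (F.toℕ i)))
  bwd : (e : UEdge G) (i : Fin t) →
        SubE G t (pathPos e (suc (F.toℕ i))) (pathPos e (F.toℕ i))

S : ℕ → FinGraph → Graph
S t G = record { V = SubV G t ; E = SubE G t }

-- G^{(2r+1)/(2s+1)} := (S_{2s+1}(G))^{2r+1}
_^⟨_/_⟩ : FinGraph → ℕ → ℕ → Graph
G ^⟨ r / s ⟩ = S (suc (2 * s)) G ^[ suc (2 * r) ]

-- Cycles and odd girth.
-- A cycle of length m+1: distinct vertices c₀,…,c_m with c_i ~ c_{i+1}
-- and c_m ~ c₀ (for m = 0 this is a loop).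

record Cycle (G : FinGraph) (m : ℕ) : Set where
  field
    c        : Fin (suc m) → Fin (n G)
    distinct : Injective _≡_ _≡_ c
    consec   : ∀ (i : Fin m) → adj G (c (inject₁ i)) (c (F.suc i))
    closing  : adj G (c (fromℕ m)) (c F.zero)

-- "k < og(G)": G has no odd cycle of length ≤ k.
OddGirthAbove : ℕ → FinGraph → Set
OddGirthAbove k G = ∀ j → suc (2 * j) ≤ k → ¬ Cycle G (2 * j)

-- Write t = 2s+1.  Each edge uv of G becomes a path of length t from u to v in S_t(G), so
-- G → S_t(G)^t; and an edge uv of G^t is witnessed by a walk of length t in G, onto which the
-- path subdividing uv can be laid, so S_t(G^t) → G for every G.  For S_t(G)^t → G, send the
-- vertex at distance q from u on the path subdividing uv to u or v according to the parity
-- of q.  A walk of length t in S_t(G) is too short to traverse two of these paths, so it can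
-- only pass from one path to another through a common end; tracking positions and their
-- parities shows that its two ends are sent to the two ends of one edge of G.
module Submission where

open import Defs
open import Data.Bool.Base using (Bool; true; false; not)
open import Data.Empty using (⊥-elim)
open import Data.Fin.Base using (Fin; toℕ; fromℕ<)
open import Data.Fin.Properties using (toℕ-fromℕ<; toℕ<n) renaming (≤-total to ≤ᶠ-total)
open import Data.Nat.Base
  using (ℕ; zero; suc; _+_; _*_; _∸_; _≤_; _<_; z≤n; s≤s; parity)
open import Data.Nat.Properties
  using (_<?_; ≤-refl; ≤-trans; ≤-pred; <⇒≤; ≮⇒≥; <⇒≱; ≤-reflexive; <-irrelevant; suc-injective;
         m≤n⇒m<n∨m≡n; m∸n≤m; m∸n+n≡m; m∸[m∸n]≡n; +-∸-assoc; m<n⇒0<n∸m; ∸-monoʳ-<)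
open import Data.Parity.Base using (Parity; 0ℙ; 1ℙ; _⁻¹) renaming (_+_ to _+ℙ_)
import Data.Parity.Properties as ℙ
open import Data.Product.Base using (Σ; _×_; _,_)
open import Data.Sum.Base using (inj₁; inj₂)
open import Relation.Nullary using (Dec; yes; no)
open import Relation.Nullary.Decidable using (toWitness; fromWitness)
open import Relation.Binary.PropositionalEquality
  using (_≡_; _≢_; refl; sym; trans; cong; subst; subst₂; module ≡-Reasoning)

module _ {Γ : Graph} where

  walk-of-sequence : ∀ k (x : ℕ → V Γ) → (∀ i → i < k → E Γ (x i) (x (suc i))) →
                     Walk Γ k (x 0) (x k)
  walk-of-sequence zero    x edge = here
  walk-of-sequence (suc k) x edge =
    step (edge 0 (s≤s z≤n))
         (walk-of-sequence k (λ i → x (suc i)) (λ i i<k → edge (suc i) (s≤s i<k)))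

  vertexAt : ∀ {k u v} → Walk Γ k u v → ℕ → V Γ
  vertexAt {u = u} here       _       = u
  vertexAt {u = u} (step _ _) zero    = u
  vertexAt         (step _ w) (suc i) = vertexAt w i

  vertexAt-zero : ∀ {k u v} (w : Walk Γ k u v) → vertexAt w 0 ≡ u
  vertexAt-zero here       = refl
  vertexAt-zero (step _ _) = refl

  vertexAt-end : ∀ {k u v} (w : Walk Γ k u v) → vertexAt w k ≡ v
  vertexAt-end here       = refl
  vertexAt-end (step _ w) = vertexAt-end w

  vertexAt-adj : ∀ {k u v} (w : Walk Γ k u v) i → i < k →
                 E Γ (vertexAt w i) (vertexAt w (suc i))
  vertexAt-adj (step {u = u} e w) zero    _         = subst (E Γ u) (sym (vertexAt-zero w)) e
  vertexAt-adj (step e w)         (suc i) (s≤s i<k) = vertexAt-adj w i i<k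

∸-suc : ∀ {m n} → n < m → m ∸ n ≡ suc (m ∸ suc n)
∸-suc = +-∸-assoc 1

data Consecutive : ℕ → ℕ → Set where
  up   : ∀ n → Consecutive (suc n) n
  down : ∀ n → Consecutive n (suc n)

consecutive-≤ : ∀ {x y n} → Consecutive x y → y < n → x ≤ n
consecutive-≤ (up _)   y<n = y<n
consecutive-≤ (down _) y<n = <⇒≤ (<⇒≤ y<n)

consecutive-∸ : ∀ n {x y} → Consecutive x y → x ≤ n → y ≤ n → Consecutive (n ∸ x) (n ∸ y)
consecutive-∸ n (up y)   x≤n _   = subst (Consecutive (n ∸ suc y)) (sym (∸-suc x≤n)) (down _)
consecutive-∸ n (down x) _   y≤n = subst (λ z → Consecutive z (n ∸ suc x)) (sym (∸-suc y≤n)) (up _)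

parity-suc : ∀ n → parity (suc n) ≡ parity n ⁻¹
parity-suc = ℙ.+-homo-+ 1

consecutive-parity : ∀ {x y} → Consecutive x y → parity x ≡ parity y ⁻¹
consecutive-parity (up n)   = parity-suc n
consecutive-parity (down n) = sym (trans (cong _⁻¹ (parity-suc n)) (ℙ.⁻¹-involutive _))

parity-odd : ∀ s → parity (suc (2 * s)) ≡ 1ℙ
parity-odd s = trans (parity-suc (2 * s)) (cong _⁻¹ (ℙ.*-homo-* 2 s))

⁻¹-distribʳ-+ : ∀ x y → (x +ℙ y) ⁻¹ ≡ x +ℙ y ⁻¹
⁻¹-distribʳ-+ 0ℙ y = refl
⁻¹-distribʳ-+ 1ℙ y = refl

⁻¹-distribˡ-+ : ∀ x y → (x +ℙ y) ⁻¹ ≡ x ⁻¹ +ℙ y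
⁻¹-distribˡ-+ 0ℙ y = refl
⁻¹-distribˡ-+ 1ℙ y = ℙ.⁻¹-involutive y

parity-∸ : ∀ {n q} → parity n ≡ 1ℙ → q ≤ n → parity (n ∸ q) ≡ parity q ⁻¹
parity-∸ {n} {q} n-odd q≤n = ℙ.+-cancelʳ-≡ (parity q) (parity (n ∸ q)) (parity q ⁻¹) (begin
  parity (n ∸ q) +ℙ parity q  ≡⟨ sym (ℙ.+-homo-+ (n ∸ q) q) ⟩
  parity (n ∸ q + q)          ≡⟨ cong parity (m∸n+n≡m q≤n) ⟩
  parity n                    ≡⟨ n-odd ⟩
  1ℙ                          ≡⟨ sym (ℙ.p⁻¹+p≡1ℙ (parity q)) ⟩
  parity q ⁻¹ +ℙ parity q     ∎)
  where open ≡-Reasoning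

parity-step : ∀ p k {q q′} → parity q ≡ parity p +ℙ parity k → Consecutive q′ q →
              parity q′ ≡ parity p +ℙ parity (suc k)
parity-step p k {q} {q′} par q′~q = begin
  parity q′                     ≡⟨ consecutive-parity q′~q ⟩
  parity q ⁻¹                   ≡⟨ cong _⁻¹ par ⟩
  (parity p +ℙ parity k) ⁻¹     ≡⟨ ⁻¹-distribʳ-+ (parity p) (parity k) ⟩
  parity p +ℙ parity k ⁻¹       ≡⟨ cong (parity p +ℙ_) (sym (parity-suc k)) ⟩
  parity p +ℙ parity (suc k)    ∎
  where open ≡-Reasoning

module Subdivision (G : FinGraph) (m : ℕ) where

  t : ℕ
  t = suc m

  pos : UEdge G → ℕ → SubV G t
  pos = pathPos

  orig-injective : ∀ {a b} → orig {G} {t} a ≡ orig b → a ≡ b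
  orig-injective refl = refl

  pathPos-interior : ∀ e {j} (j<m : j < m) → pos e (suc j) ≡ inner e (fromℕ< j<m)
  pathPos-interior e {j} j<m with j <? m
  ... | yes j<m′ = cong (λ p → inner e (fromℕ< p)) (<-irrelevant j<m′ j<m)
  ... | no  j≮m  = ⊥-elim (j≮m j<m)

  pathPos-beyond : ∀ e {j} → m ≤ j → pos e (suc j) ≡ orig (ends₂ e)
  pathPos-beyond e {j} m≤j with j <? m
  ... | yes j<m = ⊥-elim (<⇒≱ j<m m≤j)
  ... | no  _   = refl

  pathPos-interior≢orig : ∀ e {j c} → j < m → pos e (suc j) ≢ orig c
  pathPos-interior≢orig e j<m eq with trans (sym (pathPos-interior e j<m)) eq
  ... | ()

  pathPos-inner-inv : ∀ e {e′ J} j → pos e j ≡ inner e′ J → e ≡ e′ × j ≡ suc (toℕ J)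
  pathPos-inner-inv e zero    ()
  pathPos-inner-inv e {e′} {J} (suc j) eq = from (j <? m)
    where
      from : Dec (j < m) → e ≡ e′ × suc j ≡ suc (toℕ J)
      from (yes j<m) with trans (sym (pathPos-interior e j<m)) eq
      ... | refl = refl , cong suc (sym (toℕ-fromℕ< j<m))
      from (no j≮m) with trans (sym (pathPos-beyond e (≮⇒≥ j≮m))) eq
      ... | ()

  pathPos-fwd : ∀ e i → i < t → SubE G t (pos e i) (pos e (suc i))
  pathPos-fwd e i i<t =
    subst (λ j → SubE G t (pos e j) (pos e (suc j))) (toℕ-fromℕ< i<t) (fwd e (fromℕ< i<t))

  pathPos-bwd : ∀ e i → i < t → SubE G t (pos e (suc i)) (pos e i)
  pathPos-bwd e i i<t =
    subst (λ j → SubE G t (pos e (suc j)) (pos e j)) (toℕ-fromℕ< i<t) (bwd e (fromℕ< i<t))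

  record Arc : Set where
    constructor arc
    field
      edge    : UEdge G
      forward : Bool

  source : Arc → Fin (n G)
  source (arc e true)  = ends₁ e
  source (arc e false) = ends₂ e

  reverse : Arc → Arc
  reverse (arc e b) = arc e (not b)

  target : Arc → Fin (n G)
  target a = source (reverse a)

  source-target-adj : ∀ a → adj G (source a) (target a)
  source-target-adj (arc e true)  = toWitness (isEdge e)
  source-target-adj (arc e false) = adj-sym G (toWitness (isEdge e))

  along : Arc → ℕ → SubV G t
  along (arc e true)  q = pos e q
  along (arc e false) q = pos e (t ∸ q)

  along-zero : ∀ a → along a 0 ≡ orig (source a)
  along-zero (arc e true)  = refl
  along-zero (arc e false) = pathPos-beyond e ≤-refl

  along-t : ∀ a → along a t ≡ orig (target a)
  along-t (arc e true)  = pathPos-beyond e ≤-refl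
  along-t (arc e false) = cong (pos e) (m∸[m∸n]≡n (z≤n {t}))

  along-reverse : ∀ a {q} → q ≤ t → along a q ≡ along (reverse a) (t ∸ q)
  along-reverse (arc e true)  q≤t = cong (pos e) (sym (m∸[m∸n]≡n q≤t))
  along-reverse (arc e false) _   = refl

  along-step : ∀ a i → i < t → SubE G t (along a i) (along a (suc i))
  along-step (arc e true)  i i<t = pathPos-fwd e i i<t
  along-step (arc e false) i i<t =
    subst (λ j → SubE G t (pos e j) (pos e (t ∸ suc i))) (sym (∸-suc i<t))
          (pathPos-bwd e (t ∸ suc i) (s≤s (m∸n≤m m i)))

  walk-along : ∀ a → Walk (S t G) t (orig (source a)) (orig (target a))
  walk-along a = subst₂ (Walk (S t G) t) (along-zero a) (along-t a)
                        (walk-of-sequence t (along a) (along-step a))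

  neighbour-of-orig : ∀ {u w c} → SubE G t u w → w ≡ orig c →
                      Σ Arc λ a → source a ≡ c × u ≡ along a 1
  neighbour-of-orig (fwd e i) w≡c with m≤n⇒m<n∨m≡n (≤-pred (toℕ<n i))
  ... | inj₁ i<m = ⊥-elim (pathPos-interior≢orig e i<m w≡c)
  ... | inj₂ i≡m =
    arc e false , orig-injective (trans (sym (pathPos-beyond e (≤-reflexive (sym i≡m)))) w≡c)
                , cong (pos e) i≡m
  neighbour-of-orig (bwd e i) w≡c with toℕ i | toℕ<n i
  ... | zero  | _         = arc e true , orig-injective w≡c , refl
  ... | suc j | s≤s j<m   = ⊥-elim (pathPos-interior≢orig e j<m w≡c)

  neighbour-of-pathPos : ∀ {u w} e {q} → SubE G t u w → w ≡ pos e q → 0 < q → q < t →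
                        Σ ℕ λ q′ → Consecutive q′ q × u ≡ pos e q′
  neighbour-of-pathPos e {suc j} (fwd e′ i) w≡ _ (s≤s j<m)
    with pathPos-inner-inv e′ (suc (toℕ i)) (trans w≡ (pathPos-interior e j<m))
  ... | refl , i≡ = j , down j , cong (pos e) (trans (suc-injective i≡) (toℕ-fromℕ< j<m))
  neighbour-of-pathPos e {suc j} (bwd e′ i) w≡ _ (s≤s j<m)
    with pathPos-inner-inv e′ (toℕ i) (trans w≡ (pathPos-interior e j<m))
  ... | refl , i≡ =
    suc (suc j) , up (suc j) , cong (λ k → pos e (suc k)) (trans i≡ (cong suc (toℕ-fromℕ< j<m)))

  neighbour-along : ∀ {u w} a {q} → SubE G t u w → w ≡ along a q → 0 < q → q < t →
                    Σ ℕ λ q′ → Consecutive q′ q × u ≡ along a q′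
  neighbour-along (arc e true) uw w≡ 0<q q<t = neighbour-of-pathPos e uw w≡ 0<q q<t
  neighbour-along (arc e false) {q} uw w≡ 0<q q<t
    with neighbour-of-pathPos e {t ∸ q} uw w≡ (m<n⇒0<n∸m q<t) (∸-monoʳ-< 0<q (<⇒≤ q<t))
  ... | q′ , q′~t∸q , u≡ =
    t ∸ q′ ,
    subst (Consecutive (t ∸ q′)) (m∸[m∸n]≡n (<⇒≤ q<t)) (consecutive-∸ t q′~t∸q q′≤t (m∸n≤m t q)) ,
    trans u≡ (along-reverse (arc e true) q′≤t)
    where
      q′≤t : q′ ≤ t
      q′≤t = consecutive-≤ q′~t∸q (∸-monoʳ-< 0<q (<⇒≤ q<t))

  interpolate : (UEdge G → ℕ → Fin (n G)) → SubV G t → Fin (n G)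
  interpolate ℓ (orig a)    = a
  interpolate ℓ (inner e j) = ℓ e (suc (toℕ j))

  interpolate-pathPos : ∀ ℓ → (∀ e → ℓ e 0 ≡ ends₁ e) → (∀ e → ℓ e t ≡ ends₂ e) →
                        ∀ e i → i ≤ t → interpolate ℓ (pos e i) ≡ ℓ e i
  interpolate-pathPos ℓ ℓ-zero ℓ-t e zero    _ = sym (ℓ-zero e)
  interpolate-pathPos ℓ ℓ-zero ℓ-t e (suc j) (s≤s j≤m) with m≤n⇒m<n∨m≡n j≤m
  ... | inj₁ j<m  = trans (cong (interpolate ℓ) (pathPos-interior e j<m))
                          (cong (λ k → ℓ e (suc k)) (toℕ-fromℕ< j<m))
  ... | inj₂ refl = trans (cong (interpolate ℓ) (pathPos-beyond e ≤-refl)) (sym (ℓ-t e))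

⟶subdivision-power : ∀ G m → toGraph G ⟶ (S (suc m) G ^[ suc m ])
⟶subdivision-power G m = orig , subdivide
  where
    open Subdivision G m

    subdivide : ∀ {u v} → adj G u v → Walk (S t G) t (orig u) (orig v)
    subdivide {u} {v} uv with ≤ᶠ-total u v
    ... | inj₁ u≤v = walk-along (arc (uedge u v u≤v (fromWitness uv)) true)
    ... | inj₂ v≤u = walk-along (arc (uedge v u v≤u (fromWitness (adj-sym G uv))) false)

subdivision-of-power⟶ : ∀ G m → S (suc m) (G ^ᶠ[ suc m ]) ⟶ toGraph G
subdivision-of-power⟶ G m = interpolate ℓ , λ where
    (fwd e i) → interpolate-adj e (toℕ i) (toℕ<n i)
    (bwd e i) → adj-sym G (interpolate-adj e (toℕ i) (toℕ<n i))
  where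
    open Subdivision (G ^ᶠ[ suc m ]) m

    ℓ : UEdge (G ^ᶠ[ t ]) → ℕ → Fin (n G)
    ℓ e = vertexAt (toWitness (isEdge e))

    interpolate-pos : ∀ e i → i ≤ t → interpolate ℓ (pos e i) ≡ ℓ e i
    interpolate-pos = interpolate-pathPos ℓ (λ e → vertexAt-zero (toWitness (isEdge e)))
                                            (λ e → vertexAt-end (toWitness (isEdge e)))

    interpolate-adj : ∀ e i → i < t →
                      adj G (interpolate ℓ (pos e i)) (interpolate ℓ (pos e (suc i)))
    interpolate-adj e i i<t =
      subst₂ (adj G) (sym (interpolate-pos e i (<⇒≤ i<t))) (sym (interpolate-pos e (suc i) i<t))
             (vertexAt-adj (toWitness (isEdge e)) i i<t)

module OddSubdivision (G : FinGraph) (s : ℕ) where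

  open Subdivision G (2 * s)

  parity-t : parity t ≡ 1ℙ
  parity-t = parity-odd s

  arcEnd : Arc → Parity → Fin (n G)
  arcEnd a 0ℙ = source a
  arcEnd a 1ℙ = target a

  arcEnd-reverse : ∀ a x → arcEnd a (x ⁻¹) ≡ arcEnd (reverse a) x
  arcEnd-reverse (arc e true)  0ℙ = refl
  arcEnd-reverse (arc e true)  1ℙ = refl
  arcEnd-reverse (arc e false) 0ℙ = refl
  arcEnd-reverse (arc e false) 1ℙ = refl

  arcEnd-adj : ∀ a a′ x → source a′ ≡ source a → adj G (arcEnd a′ (x ⁻¹)) (arcEnd a x)
  arcEnd-adj a a′ 0ℙ eq = subst (adj G (target a′)) eq (adj-sym G (source-target-adj a′))
  arcEnd-adj a a′ 1ℙ eq = subst (λ z → adj G z (target a)) (sym eq) (source-target-adj a)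

  collapse : SubV G t → Fin (n G)
  collapse = interpolate (λ e i → arcEnd (arc e true) (parity i))

  collapse-pathPos : ∀ e {q} → q ≤ t → collapse (pos e q) ≡ arcEnd (arc e true) (parity q)
  collapse-pathPos e {q} q≤t =
    interpolate-pathPos _ (λ _ → refl) (λ e → cong (arcEnd (arc e true)) parity-t) e q q≤t

  collapse-along : ∀ a {q} → q ≤ t → collapse (along a q) ≡ arcEnd a (parity q)
  collapse-along (arc e true)  q≤t = collapse-pathPos e q≤t
  collapse-along (arc e false) {q} q≤t = begin
    collapse (pos e (t ∸ q))                ≡⟨ collapse-pathPos e (m∸n≤m t q) ⟩
    arcEnd (arc e true) (parity (t ∸ q))    ≡⟨ cong (arcEnd (arc e true)) (parity-∸ parity-t q≤t) ⟩
    arcEnd (arc e true) (parity q ⁻¹)       ≡⟨ arcEnd-reverse (arc e true) (parity q) ⟩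
    arcEnd (arc e false) (parity q)         ∎
    where open ≡-Reasoning

  -- A walk of length k ≤ t ending at v = along a p either stays on the arc a, or has crossed
  -- its source and is within distance k of it on another arc; both cases keep the parity of
  -- the position of u equal to that of p + k.
  data Anchored (k : ℕ) (u v : SubV G t) : Set where
    on-same-arc : ∀ a {p q} → p ≤ t → q ≤ t → v ≡ along a p → u ≡ along a q →
                  parity q ≡ parity p +ℙ parity k → Anchored k u v
    on-sibling-arcs : ∀ a a′ {p q} → source a′ ≡ source a → p ≤ t → q ≤ k →
                      v ≡ along a p → u ≡ along a′ q →
                      parity q ≡ parity p +ℙ parity k → Anchored k u v

  step-from-source : ∀ {k u w v} a {p} → SubE G t u w → w ≡ orig (source a) → p ≤ t →
                     v ≡ along a p → 0ℙ ≡ parity p +ℙ parity k → Anchored (suc k) u v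
  step-from-source {k} a {p} uw w≡ p≤t v≡ par with neighbour-of-orig uw w≡
  ... | a′ , src , u≡ = on-sibling-arcs a a′ src p≤t (s≤s z≤n) v≡ u≡ (parity-step p k par (up 0))

  step-sibling : ∀ {k u w v} a a′ {p q} → SubE G t u w → suc k ≤ t → source a′ ≡ source a →
                 p ≤ t → q ≤ k → v ≡ along a p → w ≡ along a′ q →
                 parity q ≡ parity p +ℙ parity k → Anchored (suc k) u v
  step-sibling a a′ {q = zero} uw _ src p≤t _ v≡ w≡ par =
    step-from-source a uw (trans w≡ (trans (along-zero a′) (cong orig src))) p≤t v≡ par
  step-sibling {k} a a′ {p} {suc q} uw k<t src p≤t q<k v≡ w≡ par
    with neighbour-along a′ uw w≡ (s≤s z≤n) (≤-trans (s≤s q<k) k<t)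
  ... | q′ , q′~q , u≡ =
    on-sibling-arcs a a′ src p≤t (consecutive-≤ q′~q (s≤s q<k)) v≡ u≡ (parity-step p k par q′~q)

  step-same : ∀ {k u w v} a {p q} → SubE G t u w → p ≤ t → q ≤ t → v ≡ along a p →
              w ≡ along a q → parity q ≡ parity p +ℙ parity k → Anchored (suc k) u v
  step-same a {q = zero} uw p≤t _ v≡ w≡ par =
    step-from-source a uw (trans w≡ (along-zero a)) p≤t v≡ par
  step-same {k} a {p} {suc q} uw p≤t q<t v≡ w≡ par with m≤n⇒m<n∨m≡n q<t
  ... | inj₁ 1+q<t with neighbour-along a uw w≡ (s≤s z≤n) 1+q<t
  ...   | q′ , q′~q , u≡ =
    on-same-arc a p≤t (consecutive-≤ q′~q 1+q<t) v≡ u≡ (parity-step p k par q′~q)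
  step-same {k} a {p} {suc q} uw p≤t q<t v≡ w≡ par | inj₂ refl =
    step-from-source (reverse a) uw (trans w≡ (along-t a)) (m∸n≤m t p)
                     (trans v≡ (along-reverse a p≤t)) turned
    where
      open ≡-Reasoning
      turned : 0ℙ ≡ parity (t ∸ p) +ℙ parity k
      turned = begin
        0ℙ                            ≡⟨ cong _⁻¹ (sym parity-t) ⟩
        parity t ⁻¹                   ≡⟨ cong _⁻¹ par ⟩
        (parity p +ℙ parity k) ⁻¹     ≡⟨ ⁻¹-distribˡ-+ (parity p) (parity k) ⟩
        parity p ⁻¹ +ℙ parity k       ≡⟨ cong (_+ℙ parity k) (sym (parity-∸ parity-t p≤t)) ⟩
        parity (t ∸ p) +ℙ parity k    ∎

  step-anchored : ∀ {k u w v} → SubE G t u w → Anchored k w v → suc k ≤ t → Anchored (suc k) u v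
  step-anchored uw (on-same-arc a p≤t q≤t v≡ w≡ par)         _   = step-same a uw p≤t q≤t v≡ w≡ par
  step-anchored uw (on-sibling-arcs a a′ src p≤t q≤k v≡ w≡ par) k<t =
    step-sibling a a′ uw k<t src p≤t q≤k v≡ w≡ par

  anchored-edge : ∀ {w v} → SubE G t w v → Anchored 0 v v
  anchored-edge (fwd e i) =
    on-same-arc (arc e true) (toℕ<n i) (toℕ<n i) refl refl (sym (ℙ.+-identityʳ _))
  anchored-edge (bwd e i) =
    on-same-arc (arc e true) (<⇒≤ (toℕ<n i)) (<⇒≤ (toℕ<n i)) refl refl (sym (ℙ.+-identityʳ _))

  anchored-walk : ∀ {k u v} → Walk (S t G) (suc k) u v → suc k ≤ t → Anchored (suc k) u v
  anchored-walk (step uw here)         k<t = step-anchored uw (anchored-edge uw) k<t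
  anchored-walk (step uw (step wx xv)) k<t =
    step-anchored uw (anchored-walk (step wx xv) (<⇒≤ k<t)) k<t

  collapse-anchor : ∀ a {p q u} → q ≤ t → u ≡ along a q → parity q ≡ parity p +ℙ parity t →
                    collapse u ≡ arcEnd a (parity p ⁻¹)
  collapse-anchor a {p} {q} {u} q≤t u≡ par = begin
    collapse u                   ≡⟨ cong collapse u≡ ⟩
    collapse (along a q)         ≡⟨ collapse-along a q≤t ⟩
    arcEnd a (parity q)          ≡⟨ cong (arcEnd a) (trans par (cong (parity p +ℙ_) parity-t)) ⟩
    arcEnd a (parity p +ℙ 1ℙ)    ≡⟨ cong (arcEnd a) (ℙ.+-comm (parity p) 1ℙ) ⟩
    arcEnd a (parity p ⁻¹)       ∎
    where open ≡-Reasoning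

  anchored-adj : ∀ {u v} → Anchored t u v → adj G (collapse u) (collapse v)
  anchored-adj (on-same-arc a {p} p≤t q≤t v≡ u≡ par) =
    subst₂ (adj G) (sym (collapse-anchor a {p} q≤t u≡ par))
                   (sym (trans (cong collapse v≡) (collapse-along a p≤t)))
                   (arcEnd-adj a a (parity p) refl)
  anchored-adj (on-sibling-arcs a a′ {p} src p≤t q≤t v≡ u≡ par) =
    subst₂ (adj G) (sym (collapse-anchor a′ {p} q≤t u≡ par))
                   (sym (trans (cong collapse v≡) (collapse-along a p≤t)))
                   (arcEnd-adj a a′ (parity p) src)

  odd-subdivision-power⟶ : (S t G ^[ t ]) ⟶ toGraph G
  odd-subdivision-power⟶ = collapse , λ w → anchored-adj (anchored-walk w ≤-refl)

open OddSubdivision using (odd-subdivision-power⟶)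

lemma2p1 : (G : FinGraph) →
    ((s : ℕ) → (G ^⟨ s / s ⟩) ⟷ toGraph G)
    × ((s : ℕ) → OddGirthAbove (suc (2 * s)) G →
    (S (suc (2 * s)) (G ^ᶠ[ suc (2 * s) ])) ⟶ toGraph G)
lemma2p1 G = (λ s → odd-subdivision-power⟶ G s , ⟶subdivision-power G (2 * s))
           , (λ s _ → subdivision-of-power⟶ G (2 * s))
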